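{- Let $S$ and $T$ be finite sets, and let $\mathcal{V}\le\mathcal{P}(S)$ and $\mathcal{W}\le\mathcal{P}(T)$ be linear subspaces. If there exists a $(\mathcal{V},\mathcal{W})$-isomorphism $S\to T$, then the multisets of Venn region cardinalities for $\mathrm{Venn}(S,\mathcal{V})$ and $\mathrm{Venn}(T,\mathcal{W})$ are the same.
   Context: $\mathcal{P}(S)$ is an $\mathbb{F}_2$-vector space under symmetric difference. A $(\mathcal{V},\mathcal{W})$-isomorphism is a bijection $g:S\to T$ with $\{g(X):X\in\mathcal{V}\}=\mathcal{W}$. For a basis $\mathscr{X}=(X_1,\dots,X_r)$ of $\mathcal{V}$, the Venn regions are $v_{\mathscr{X}}(\vec a)=\bigcap_{i\in I_{\vec a}}X_i\cap\bigcap_{i\notin I_{\vec a}}(S\setminus X_i)$ for $\vec a\in\mathbb{F}_2^r$ with support $I_{\vec a}$; the multiset of Venn region cardinalities is $\{|v_{\mathscr{X}}(\vec a)|:\vec a\in\mathbb{F}_2^r\}$ counted with multiplicity. -}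

module Defs where

open import Data.Nat using (ℕ; zero; suc)
open import Data.Bool using (Bool; true; false; if_then_else_; _xor_)
open import Data.Fin using (Fin)
open import Data.Fin.Subset using (Subset; ⊥; ⊤; ∁; _∩_; ∣_∣)
open import Data.Vec using (Vec; []; _∷_; zipWith; tabulate; lookup)
open import Data.List using (List; []; _∷_; map; _++_)
open import Data.Product using (Σ; _×_; ∃)
open import Function.Bundles using (_↔_; Inverse)
open import Relation.Binary.PropositionalEquality using (_≡_)

-- Symmetric difference: the addition of the F₂-vector space 𝒫(Fin n).
_Δ_ : ∀ {n} → Subset n → Subset n → Subset n
_Δ_ = zipWith _xor_

-- A family of subsets (given as a predicate) is a linear subspace of 𝒫(Fin n)
-- over F₂: contains ∅ and is closed under symmetric difference
-- (closure under F₂-scalars is then automatic).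
record IsSubspace {n : ℕ} (V : Subset n → Set) : Set where
  field
    has-∅ : V ⊥
    closed-Δ : ∀ {X Y} → V X → V Y → V (X Δ Y)

lincomb : ∀ {n r} → Vec (Subset n) r → Vec Bool r → Subset n
lincomb [] [] = ⊥
lincomb (X ∷ Xs) (a ∷ as) = (if a then X else ⊥) Δ lincomb Xs as

record IsBasis {n r : ℕ} (V : Subset n → Set) (𝒳 : Vec (Subset n) r) : Set where
  field
    inV : ∀ i → V (lookup 𝒳 i)
    independent : ∀ a b → lincomb 𝒳 a ≡ lincomb 𝒳 b → a ≡ b
    spanning : ∀ Y → V Y → ∃ λ a → lincomb 𝒳 a ≡ Y

vennRegion : ∀ {n r} → Vec (Subset n) r → Vec Bool r → Subset n
vennRegion [] [] = ⊤
vennRegion (X ∷ Xs) (a ∷ as) = (if a then X else ∁ X) ∩ vennRegion Xs as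

allVecs : (r : ℕ) → List (Vec Bool r)
allVecs zero = [] ∷ []
allVecs (suc r) = map (true ∷_) (allVecs r) ++ map (false ∷_) (allVecs r)

-- The multiset {|v_𝒳(a)| : a ∈ F₂^r} as a list (compare up to permutation).
vennCardinalities : ∀ {n r} → Vec (Subset n) r → List ℕ
vennCardinalities {r = r} 𝒳 = map (λ a → ∣ vennRegion 𝒳 a ∣) (allVecs r)

image : ∀ {n m} → Fin n ↔ Fin m → Subset n → Subset m
image g X = tabulate (λ j → lookup X (Inverse.from g j))

IsVWIso : ∀ {n m} → (Subset n → Set) → (Subset m → Set) → Fin n ↔ Fin m → Set
IsVWIso V W g = (∀ X → V X → W (image g X))
              × (∀ Y → W Y → Σ _ λ X → V X × image g X ≡ Y)

-- Regard a family 𝒳 = (X₁,…,X_r) as an r × n incidence matrix over F₂.  A point x lies in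
-- the Venn region v_𝒳(a) exactly when its column is a, and the members of span 𝒳 are the
-- sets {x : c · column x = 1}.  Transporting the bases along a (V,W)-isomorphism g, each
-- g(Xᵢ) is a combination of the Yⱼ and vice versa, so the columns of 𝒳 and 𝒴 are related by
-- F₂-linear maps that are mutually inverse: they compose to the identity on all columns,
-- hence, by independence of the rows, on all of F₂^r.  Such an invertible ψ satisfies
-- v_𝒴(d) = g(v_𝒳(ψ d)), and reindexing F₂^s along ψ permutes the list of cardinalities.
module Submission where

open import Defs
open import Algebra.Bundles using (CommutativeRing)
open import Data.Bool using (Bool; true; false; _xor_; _∧_; not; if_then_else_)
import Data.Bool as Bool
open import Data.Bool.Properties using (xor-∧-commutativeRing; xor-identityʳ; ∧-distribʳ-xor)
open import Data.Fin using (Fin; zero; suc)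
open import Data.Fin.Subset using (Subset; ⊥; ∁; _∩_; ∣_∣; ⁅_⁆)
open import Data.List using (map)
open import Data.List.Membership.Propositional using (_∈_)
open import Data.List.Membership.Propositional.Properties using (∈-map⁺; ∈-map⁻; ∈-++⁺ˡ; ∈-++⁺ʳ)
open import Data.List.Membership.Propositional.Properties.WithK using (unique∧set⇒bag)
open import Data.List.Properties using (map-∘; map-cong)
open import Data.List.Relation.Binary.BagAndSetEquality using (∼bag⇒↭)
open import Data.List.Relation.Binary.Permutation.Propositional using (_↭_; module PermutationReasoning)
import Data.List.Relation.Binary.Permutation.Propositional.Properties as ↭
open import Data.List.Relation.Unary.Any using (here)
open import Data.List.Relation.Unary.All using ([])
open import Data.List.Relation.Unary.AllPairs using ([]; _∷_)
open import Data.List.Relation.Unary.Unique.Propositional using (Unique)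
import Data.List.Relation.Unary.Unique.Propositional.Properties as Unique
open import Data.Nat using (ℕ; suc)
open import Data.Nat.Properties using (+-0-commutativeMonoid)
open import Data.Product using (Σ; ∃; _,_; proj₁; proj₂; _×_)
open import Data.Vec using (Vec; []; _∷_; lookup; tabulate)
open import Data.Vec.Properties
  using (lookup∘tabulate; tabulate∘lookup; tabulate-cong; lookup-zipWith; lookup-replicate; lookup-map; ≡-dec; ∷-injectiveʳ)
open import Function using (_∘_; mk⇔)
open import Function.Bundles using (_↔_; Inverse; Injection; mk↔ₛ′)
open import Function.Properties.Inverse using (↔⇒↣)
open import Relation.Nullary using (¬_; Dec; does)
open import Relation.Nullary.Decidable using (does-⇔)
open import Relation.Binary.PropositionalEquality

open import Algebra.Properties.CommutativeSemigroup
  (CommutativeRing.+-commutativeSemigroup xor-∧-commutativeRing) using (interchange)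
open import Algebra.Properties.CommutativeMonoid.Sum +-0-commutativeMonoid
  using (sum; sum-permute; sum-cong-≗)

private
  variable
    n m r s : ℕ

lookup-ext : ∀ {A : Set} {u v : Vec A n} → (∀ i → lookup u i ≡ lookup v i) → u ≡ v
lookup-ext {u = u} {v} u≗v =
  trans (sym (tabulate∘lookup u)) (trans (tabulate-cong u≗v) (tabulate∘lookup v))

allVecs-complete : ∀ r (a : Vec Bool r) → a ∈ allVecs r
allVecs-complete ℕ.zero  []          = here refl
allVecs-complete (suc r) (true ∷ a)  = ∈-++⁺ˡ (∈-map⁺ (true ∷_) (allVecs-complete r a))
allVecs-complete (suc r) (false ∷ a) =
  ∈-++⁺ʳ (map (true ∷_) (allVecs r)) (∈-map⁺ (false ∷_) (allVecs-complete r a))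

allVecs-unique : ∀ r → Unique (allVecs r)
allVecs-unique ℕ.zero  = [] ∷ []
allVecs-unique (suc r) = Unique.++⁺ (prefixed true) (prefixed false) heads-differ
  where
  prefixed : ∀ b → Unique (map (b ∷_) (allVecs r))
  prefixed b = Unique.map⁺ ∷-injectiveʳ (allVecs-unique r)

  heads-differ : ∀ {v} → ¬ (v ∈ map (true ∷_) (allVecs r) × v ∈ map (false ∷_) (allVecs r))
  heads-differ (p , q) with ∈-map⁻ (true ∷_) p | ∈-map⁻ (false ∷_) q
  ... | _ , _ , refl | _ , _ , ()

allVecs-↭ : (π : Vec Bool s ↔ Vec Bool r) → map (Inverse.to π) (allVecs s) ↭ allVecs r
allVecs-↭ {s} {r} π = ∼bag⇒↭ (unique∧set⇒bag
  (Unique.map⁺ (Injection.injective (↔⇒↣ π)) (allVecs-unique s))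
  (allVecs-unique r)
  (mk⇔ (λ _ → allVecs-complete r _) (λ _ → hit _)))
  where
  open Inverse π
  hit : ∀ a → a ∈ map to (allVecs s)
  hit a = subst (_∈ map to (allVecs s)) (strictlyInverseˡ a) (∈-map⁺ to (allVecs-complete s (from a)))

indicator : Bool → ℕ
indicator b = if b then 1 else 0

∣p∣≡sum : (p : Subset n) → ∣ p ∣ ≡ sum (indicator ∘ lookup p)
∣p∣≡sum []          = refl
∣p∣≡sum (true ∷ p)  = cong suc (∣p∣≡sum p)
∣p∣≡sum (false ∷ p) = ∣p∣≡sum p

lookup-image-to : (g : Fin n ↔ Fin m) (p : Subset n) (x : Fin n) →
                  lookup (image g p) (Inverse.to g x) ≡ lookup p x
lookup-image-to g p x = trans (lookup∘tabulate _ (to x)) (cong (lookup p) (strictlyInverseʳ x))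
  where open Inverse g

∣image∣ : (g : Fin n ↔ Fin m) (p : Subset n) → ∣ image g p ∣ ≡ ∣ p ∣
∣image∣ g p = begin
  ∣ image g p ∣                                ≡⟨ ∣p∣≡sum (image g p) ⟩
  sum (indicator ∘ lookup (image g p))         ≡⟨ sum-permute _ g ⟩
  sum (indicator ∘ lookup (image g p) ∘ to)    ≡⟨ sum-cong-≗ (cong indicator ∘ lookup-image-to g p) ⟩
  sum (indicator ∘ lookup p)                   ≡⟨ ∣p∣≡sum p ⟨
  ∣ p ∣                                        ∎
  where
  open ≡-Reasoning
  open Inverse g using (to)

column : Vec (Subset n) r → Fin n → Vec Bool r
column 𝒳 x = tabulate (λ i → lookup (lookup 𝒳 i) x)

_≟ᵥ_ : (a b : Vec Bool r) → Dec (a ≡ b)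
_≟ᵥ_ = ≡-dec Bool._≟_

infix 7 _·_
_·_ : Vec Bool r → Vec Bool r → Bool
[]       · []       = false
(a ∷ as) · (c ∷ cs) = (a ∧ c) xor (as · cs)

infixr 6 _*ᵥ_
_*ᵥ_ : (Fin s → Vec Bool r) → Vec Bool r → Vec Bool s
M *ᵥ a = tabulate (λ i → M i · a)

LinearlyIndependent : Vec (Subset n) r → Set
LinearlyIndependent 𝒳 = ∀ a b → lincomb 𝒳 a ≡ lincomb 𝒳 b → a ≡ b

·-zeroˡ : (d : Vec Bool r) → ⊥ · d ≡ false
·-zeroˡ []       = refl
·-zeroˡ (_ ∷ ds) = ·-zeroˡ ds

·-distribʳ-Δ : (u v d : Vec Bool r) → (u Δ v) · d ≡ (u · d) xor (v · d)
·-distribʳ-Δ []       []       []       = refl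
·-distribʳ-Δ (u ∷ us) (v ∷ vs) (d ∷ ds) = begin
  ((u xor v) ∧ d) xor ((us Δ vs) · ds)
    ≡⟨ cong₂ _xor_ (∧-distribʳ-xor d u v) (·-distribʳ-Δ us vs ds) ⟩
  ((u ∧ d) xor (v ∧ d)) xor ((us · ds) xor (vs · ds))
    ≡⟨ interchange (u ∧ d) (v ∧ d) (us · ds) (vs · ds) ⟩
  ((u ∧ d) xor (us · ds)) xor ((v ∧ d) xor (vs · ds)) ∎
  where open ≡-Reasoning

⁅i⁆·d≡d[i] : (i : Fin r) (d : Vec Bool r) → ⁅ i ⁆ · d ≡ lookup d i
⁅i⁆·d≡d[i] zero    (d ∷ ds) = trans (cong (d xor_) (·-zeroˡ ds)) (xor-identityʳ d)
⁅i⁆·d≡d[i] (suc i) (_ ∷ ds) = ⁅i⁆·d≡d[i] i ds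

lookup-lincomb : (𝒳 : Vec (Subset n) r) (a : Vec Bool r) (x : Fin n) →
                 lookup (lincomb 𝒳 a) x ≡ a · column 𝒳 x
lookup-lincomb []      []       x = lookup-replicate x false
lookup-lincomb (X ∷ 𝒳) (a ∷ as) x = begin
  lookup ((if a then X else ⊥) Δ lincomb 𝒳 as) x
    ≡⟨ lookup-zipWith _xor_ x (if a then X else ⊥) (lincomb 𝒳 as) ⟩
  lookup (if a then X else ⊥) x xor lookup (lincomb 𝒳 as) x
    ≡⟨ cong₂ _xor_ (lookup-scaled a) (lookup-lincomb 𝒳 as x) ⟩
  (a ∧ lookup X x) xor (as · column 𝒳 x) ∎
  where
  open ≡-Reasoning
  lookup-scaled : ∀ a → lookup (if a then X else ⊥) x ≡ a ∧ lookup X x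
  lookup-scaled true  = refl
  lookup-scaled false = lookup-replicate x false

lookup-vennRegion : (𝒳 : Vec (Subset n) r) (a : Vec Bool r) (x : Fin n) →
                    lookup (vennRegion 𝒳 a) x ≡ does (column 𝒳 x ≟ᵥ a)
lookup-vennRegion []      []       x = lookup-replicate x true
lookup-vennRegion (X ∷ 𝒳) (a ∷ as) x = begin
  lookup ((if a then X else ∁ X) ∩ vennRegion 𝒳 as) x
    ≡⟨ lookup-zipWith _∧_ x (if a then X else ∁ X) (vennRegion 𝒳 as) ⟩
  lookup (if a then X else ∁ X) x ∧ lookup (vennRegion 𝒳 as) x
    ≡⟨ cong₂ _∧_ (trans (lookup-literal a) (literal a (lookup X x))) (lookup-vennRegion 𝒳 as x) ⟩
  does (lookup X x Bool.≟ a) ∧ does (column 𝒳 x ≟ᵥ as) ∎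
  where
  open ≡-Reasoning
  lookup-literal : ∀ a → lookup (if a then X else ∁ X) x ≡ (if a then lookup X x else not (lookup X x))
  lookup-literal true  = refl
  lookup-literal false = lookup-map x not X
  literal : ∀ a b → (if a then b else not b) ≡ does (b Bool.≟ a)
  literal true  true  = refl
  literal true  false = refl
  literal false true  = refl
  literal false false = refl

·-*ᵥ : (M : Fin s → Vec Bool r) (c : Vec Bool s) (a : Vec Bool r) →
       c · (M *ᵥ a) ≡ lincomb (tabulate M) c · a
·-*ᵥ {s = ℕ.zero} M []       a = sym (·-zeroˡ a)
·-*ᵥ {s = suc s}  M (c ∷ cs) a = begin
  (c ∧ (M zero · a)) xor (cs · ((M ∘ suc) *ᵥ a))
    ≡⟨ cong₂ _xor_ (sym (scaled-· c)) (·-*ᵥ (M ∘ suc) cs a) ⟩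
  ((if c then M zero else ⊥) · a) xor (lincomb (tabulate (M ∘ suc)) cs · a)
    ≡⟨ ·-distribʳ-Δ (if c then M zero else ⊥) (lincomb (tabulate (M ∘ suc)) cs) a ⟨
  lincomb (tabulate M) (c ∷ cs) · a ∎
  where
  open ≡-Reasoning
  scaled-· : ∀ c → (if c then M zero else ⊥) · a ≡ c ∧ (M zero · a)
  scaled-· true  = refl
  scaled-· false = ·-zeroˡ a

·-column-injective : (𝒳 : Vec (Subset n) r) → LinearlyIndependent 𝒳 →
                     ∀ {c c′} → (∀ x → c · column 𝒳 x ≡ c′ · column 𝒳 x) → c ≡ c′
·-column-injective 𝒳 independent {c} {c′} c≗c′ = independent c c′ (lookup-ext λ x →
  trans (lookup-lincomb 𝒳 c x) (trans (c≗c′ x) (sym (lookup-lincomb 𝒳 c′ x))))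

-- Each row of M N is forced to be a unit vector: by independence of 𝒳, a coefficient vector
-- is determined by its products with the columns of 𝒳.
*ᵥ-inverse : (𝒳 : Vec (Subset n) r) → LinearlyIndependent 𝒳 →
             (M : Fin r → Vec Bool s) (N : Fin s → Vec Bool r) →
             (∀ x → M *ᵥ N *ᵥ column 𝒳 x ≡ column 𝒳 x) → ∀ a → M *ᵥ N *ᵥ a ≡ a
*ᵥ-inverse 𝒳 independent M N fixes a = lookup-ext λ i → begin
  lookup (M *ᵥ N *ᵥ a) i            ≡⟨ lookup∘tabulate _ i ⟩
  M i · (N *ᵥ a)                    ≡⟨ ·-*ᵥ N (M i) a ⟩
  lincomb (tabulate N) (M i) · a    ≡⟨ cong (_· a) (row-is-unit i) ⟩
  ⁅ i ⁆ · a                         ≡⟨ ⁅i⁆·d≡d[i] i a ⟩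
  lookup a i                        ∎
  where
  open ≡-Reasoning
  row-is-unit : ∀ i → lincomb (tabulate N) (M i) ≡ ⁅ i ⁆
  row-is-unit i = ·-column-injective 𝒳 independent λ x → begin
    lincomb (tabulate N) (M i) · column 𝒳 x  ≡⟨ ·-*ᵥ N (M i) (column 𝒳 x) ⟨
    M i · (N *ᵥ column 𝒳 x)                  ≡⟨ lookup∘tabulate _ i ⟨
    lookup (M *ᵥ N *ᵥ column 𝒳 x) i          ≡⟨ cong (λ v → lookup v i) (fixes x) ⟩
    lookup (column 𝒳 x) i                    ≡⟨ ⁅i⁆·d≡d[i] i _ ⟨
    ⁅ i ⁆ · column 𝒳 x                       ∎

pullback : (Fin m → Fin n) → Subset n → Subset m
pullback f X = tabulate (lookup X ∘ f)

column-pullback : {W : Subset m → Set} {𝒴 : Vec (Subset m) s} → IsBasis W 𝒴 →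
                  (f : Fin m → Fin n) (𝒳 : Vec (Subset n) r) →
                  (∀ i → W (pullback f (lookup 𝒳 i))) →
                  ∃ λ (M : Fin r → Vec Bool s) → ∀ y → column 𝒳 (f y) ≡ M *ᵥ column 𝒴 y
column-pullback {s = s} {r = r} {𝒴 = 𝒴} basis f 𝒳 pulled-in-W = M , λ y → tabulate-cong λ i → begin
  lookup (lookup 𝒳 i) (f y)             ≡⟨ lookup∘tabulate _ y ⟨
  lookup (pullback f (lookup 𝒳 i)) y    ≡⟨ cong (λ Z → lookup Z y) (coordinates i) ⟨
  lookup (lincomb 𝒴 (M i)) y            ≡⟨ lookup-lincomb 𝒴 (M i) y ⟩
  M i · column 𝒴 y                      ∎
  where
  open ≡-Reasoning
  M : Fin r → Vec Bool s
  M i = proj₁ (IsBasis.spanning basis _ (pulled-in-W i))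
  coordinates : ∀ i → lincomb 𝒴 (M i) ≡ pullback f (lookup 𝒳 i)
  coordinates i = proj₂ (IsBasis.spanning basis _ (pulled-in-W i))

pullback-image : (g : Fin n ↔ Fin m) (X : Subset n) → pullback (Inverse.to g) (image g X) ≡ X
pullback-image g X = lookup-ext λ x → trans (lookup∘tabulate _ x) (lookup-image-to g X x)

change-of-basis : {V : Subset n → Set} {W : Subset m → Set} (g : Fin n ↔ Fin m) → IsVWIso V W g →
                  {𝒳 : Vec (Subset n) r} {𝒴 : Vec (Subset m) s} → IsBasis V 𝒳 → IsBasis W 𝒴 →
                  Σ (Vec Bool s ↔ Vec Bool r) λ ψ →
                    ∀ y → column 𝒳 (Inverse.from g y) ≡ Inverse.to ψ (column 𝒴 y)
change-of-basis {r = r} {s = s} {V = V} {W} g (V⇒W , W⇒V) {𝒳} {𝒴} 𝒳-basis 𝒴-basis =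
  mk↔ₛ′ (M *ᵥ_) (N *ᵥ_) (*ᵥ-inverse 𝒳 (IsBasis.independent 𝒳-basis) M N M-N-fixes)
                        (*ᵥ-inverse 𝒴 (IsBasis.independent 𝒴-basis) N M N-M-fixes)
  , column-from
  where
  open Inverse g

  to-pullback-in-V : ∀ j → V (pullback to (lookup 𝒴 j))
  to-pullback-in-V j with W⇒V (lookup 𝒴 j) (IsBasis.inV 𝒴-basis j)
  ... | X , X∈V , gX≡Yⱼ = subst V (trans (sym (pullback-image g X)) (cong (pullback to) gX≡Yⱼ)) X∈V

  -- image g is pullback from by definition.
  from-pullback-in-W : ∀ i → W (pullback from (lookup 𝒳 i))
  from-pullback-in-W i = V⇒W (lookup 𝒳 i) (IsBasis.inV 𝒳-basis i)

  M : Fin r → Vec Bool s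
  M = proj₁ (column-pullback 𝒴-basis from 𝒳 from-pullback-in-W)
  column-from : ∀ y → column 𝒳 (from y) ≡ M *ᵥ column 𝒴 y
  column-from = proj₂ (column-pullback 𝒴-basis from 𝒳 from-pullback-in-W)

  N : Fin s → Vec Bool r
  N = proj₁ (column-pullback 𝒳-basis to 𝒴 to-pullback-in-V)
  column-to : ∀ x → column 𝒴 (to x) ≡ N *ᵥ column 𝒳 x
  column-to = proj₂ (column-pullback 𝒳-basis to 𝒴 to-pullback-in-V)

  M-N-fixes : ∀ x → M *ᵥ N *ᵥ column 𝒳 x ≡ column 𝒳 x
  M-N-fixes x = begin
    M *ᵥ N *ᵥ column 𝒳 x   ≡⟨ cong (M *ᵥ_) (column-to x) ⟨
    M *ᵥ column 𝒴 (to x)   ≡⟨ column-from (to x) ⟨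
    column 𝒳 (from (to x)) ≡⟨ cong (column 𝒳) (strictlyInverseʳ x) ⟩
    column 𝒳 x             ∎
    where open ≡-Reasoning

  N-M-fixes : ∀ y → N *ᵥ M *ᵥ column 𝒴 y ≡ column 𝒴 y
  N-M-fixes y = begin
    N *ᵥ M *ᵥ column 𝒴 y   ≡⟨ cong (N *ᵥ_) (column-from y) ⟨
    N *ᵥ column 𝒳 (from y) ≡⟨ column-to (from y) ⟨
    column 𝒴 (to (from y)) ≡⟨ cong (column 𝒴) (strictlyInverseˡ y) ⟩
    column 𝒴 y             ∎
    where open ≡-Reasoning

vennRegion-image : (g : Fin n ↔ Fin m) (ψ : Vec Bool s ↔ Vec Bool r)
                   (𝒳 : Vec (Subset n) r) (𝒴 : Vec (Subset m) s) →
                   (∀ y → column 𝒳 (Inverse.from g y) ≡ Inverse.to ψ (column 𝒴 y)) →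
                   ∀ d → vennRegion 𝒴 d ≡ image g (vennRegion 𝒳 (Inverse.to ψ d))
vennRegion-image g ψ 𝒳 𝒴 column-from d = lookup-ext λ y → begin
  lookup (vennRegion 𝒴 d) y
    ≡⟨ lookup-vennRegion 𝒴 d y ⟩
  does (column 𝒴 y ≟ᵥ d)
    ≡⟨ does-⇔ (mk⇔ (cong to) injective) (column 𝒴 y ≟ᵥ d) (to (column 𝒴 y) ≟ᵥ to d) ⟩
  does (to (column 𝒴 y) ≟ᵥ to d)
    ≡⟨ cong (λ c → does (c ≟ᵥ to d)) (column-from y) ⟨
  does (column 𝒳 (Inverse.from g y) ≟ᵥ to d)
    ≡⟨ lookup-vennRegion 𝒳 (to d) (Inverse.from g y) ⟨
  lookup (vennRegion 𝒳 (to d)) (Inverse.from g y)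
    ≡⟨ lookup∘tabulate _ y ⟨
  lookup (image g (vennRegion 𝒳 (to d))) y ∎
  where
  open ≡-Reasoning
  open Inverse ψ using (to)
  open Injection (↔⇒↣ ψ) using (injective)

vennCardinalities-↭ : (g : Fin n ↔ Fin m) (ψ : Vec Bool s ↔ Vec Bool r)
                      (𝒳 : Vec (Subset n) r) (𝒴 : Vec (Subset m) s) →
                      (∀ y → column 𝒳 (Inverse.from g y) ≡ Inverse.to ψ (column 𝒴 y)) →
                      vennCardinalities 𝒳 ↭ vennCardinalities 𝒴
vennCardinalities-↭ {s = s} {r = r} g ψ 𝒳 𝒴 column-from = begin
  map cardinality (allVecs r)                      ↭⟨ ↭.map⁺ cardinality (allVecs-↭ ψ) ⟨
  map cardinality (map (Inverse.to ψ) (allVecs s)) ≡⟨ map-∘ (allVecs s) ⟨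
  map (cardinality ∘ Inverse.to ψ) (allVecs s)     ≡⟨ map-cong region-sizes (allVecs s) ⟩
  map (λ d → ∣ vennRegion 𝒴 d ∣) (allVecs s)      ∎
  where
  open PermutationReasoning
  cardinality : Vec Bool r → ℕ
  cardinality a = ∣ vennRegion 𝒳 a ∣
  region-sizes : ∀ d → cardinality (Inverse.to ψ d) ≡ ∣ vennRegion 𝒴 d ∣
  region-sizes d = trans (sym (∣image∣ g (vennRegion 𝒳 (Inverse.to ψ d))))
                         (sym (cong ∣_∣ (vennRegion-image g ψ 𝒳 𝒴 column-from d)))

corollary4p4 : (n m : ℕ) (V : Subset n → Set) (W : Subset m → Set)
    → IsSubspace V → IsSubspace W
    → (∃ λ (g : Fin n ↔ Fin m) → IsVWIso V W g)
    → ∀ {r s} (𝒳 : Vec (Subset n) r) (𝒴 : Vec (Subset m) s)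
    → IsBasis V 𝒳 → IsBasis W 𝒴
    → vennCardinalities 𝒳 ↭ vennCardinalities 𝒴
corollary4p4 n m V W _ _ (g , iso) 𝒳 𝒴 𝒳-basis 𝒴-basis =
  let ψ , column-from = change-of-basis g iso 𝒳-basis 𝒴-basis
  in  vennCardinalities-↭ g ψ 𝒳 𝒴 column-from
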